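{- Let $M$ be a modular-magic Sudoku board and let $j\in\{0,3,6\}$. Among the three $3\times 3$ blocks of $M$ whose center entry is $j$, at least two have the same off-diagonal set.
   Context: A Sudoku board here is a $9\times 9$ grid with entries from $\{0,1,\dots,8\}$ such that each row, each column and each of the nine designated $3\times 3$ blocks (rows $3a+1..3a+3$, columns $3b+1..3b+3$) contains each symbol exactly once. In a block, the three rows, three columns and two diagonals of that $3\times 3$ block are called mini-rows, mini-columns and mini-diagonals. A modular-magic Sudoku board is a Sudoku board in which, in every block, the entries of every mini-row, every mini-column and both mini-diagonals have sum divisible by $9$. In every block of a modular-magic board, one of the two mini-diagonals has entry set $\{0,3,6\}$ (so the center entry of every block lies in $\{0,3,6\}$, and each value $0,3,6$ occurs as center of exactly three blocks). The off-diagonal set of a block is the set of the two corner entries of the other mini-diagonal (the one whose entries are not from $\{0,3,6\}$). -}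

module Defs where

open import Data.Nat using (ℕ; _+_)
open import Data.Nat.Divisibility using (_∣_)
open import Data.Fin using (Fin; toℕ; zero; suc)
open import Data.Product using (_×_; _,_; proj₁; proj₂)
open import Data.Sum using (_⊎_)
open import Function.Definitions using (Injective)
open import Relation.Binary.PropositionalEquality using (_≡_)
open import Relation.Nullary using (Dec; yes; no)
open import Data.Fin.Properties using (_≟_)

Board : Set
Board = Fin 9 → Fin 9 → Fin 9

-- block (a , b) covers rows 3a..3a+2 and columns 3b..3b+2 (0-indexed);
-- cell (i , k) of that block, i,k ∈ Fin 3.
idx : Fin 3 → Fin 3 → Fin 9
idx zero    zero    = zero
idx zero    (suc zero) = suc zero
idx zero    (suc (suc zero)) = suc (suc zero)
idx (suc zero) zero = suc (suc (suc zero))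
idx (suc zero) (suc zero) = suc (suc (suc (suc zero)))
idx (suc zero) (suc (suc zero)) = suc (suc (suc (suc (suc zero))))
idx (suc (suc zero)) zero = suc (suc (suc (suc (suc (suc zero)))))
idx (suc (suc zero)) (suc zero) = suc (suc (suc (suc (suc (suc (suc zero))))))
idx (suc (suc zero)) (suc (suc zero)) = suc (suc (suc (suc (suc (suc (suc (suc zero)))))))

Block : Set
Block = Fin 3 × Fin 3

entry : Board → Block → Fin 3 → Fin 3 → Fin 9
entry M (a , b) i k = M (idx a i) (idx b k)

-- Sudoku: each row, column and block contains each symbol exactly once
-- (9 cells, 9 symbols: equivalently, injective).
IsSudoku : Board → Set
IsSudoku M =
  (∀ r → Injective _≡_ _≡_ (λ c → M r c)) ×
  (∀ c → Injective _≡_ _≡_ (λ r → M r c)) ×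
  (∀ B → Injective _≡_ _≡_ (λ (p : Fin 3 × Fin 3) → entry M B (proj₁ p) (proj₂ p)))

sum3 : Fin 9 → Fin 9 → Fin 9 → ℕ
sum3 x y z = toℕ x + toℕ y + toℕ z

0F 1F 2F : Fin 3
0F = zero
1F = suc zero
2F = suc (suc zero)

IsModularMagic : Board → Set
IsModularMagic M = IsSudoku M ×
  (∀ B →
    (∀ i → 9 ∣ sum3 (entry M B i 0F) (entry M B i 1F) (entry M B i 2F)) ×
    (∀ k → 9 ∣ sum3 (entry M B 0F k) (entry M B 1F k) (entry M B 2F k)) ×
    (9 ∣ sum3 (entry M B 0F 0F) (entry M B 1F 1F) (entry M B 2F 2F)) ×
    (9 ∣ sum3 (entry M B 0F 2F) (entry M B 1F 1F) (entry M B 2F 0F)))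

v0 v3 v6 : Fin 9
v0 = zero
v3 = suc (suc (suc zero))
v6 = suc (suc (suc (suc (suc (suc zero)))))

In036 : Fin 9 → Set
In036 x = (x ≡ v0) ⊎ (x ≡ v3) ⊎ (x ≡ v6)

in036? : (x : Fin 9) → Dec (In036 x)
in036? x with x ≟ v0 | x ≟ v3 | x ≟ v6
... | yes p | _ | _ = yes (Data.Sum.inj₁ p)
... | no _ | yes q | _ = yes (Data.Sum.inj₂ (Data.Sum.inj₁ q))
... | no _ | no _ | yes r = yes (Data.Sum.inj₂ (Data.Sum.inj₂ r))
... | no p | no q | no r = no λ { (Data.Sum.inj₁ e) → p e ; (Data.Sum.inj₂ (Data.Sum.inj₁ e)) → q e ; (Data.Sum.inj₂ (Data.Sum.inj₂ e)) → r e }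

center : Board → Block → Fin 9
center M B = entry M B 1F 1F

-- The off-diagonal corners of block B: the corners of the mini-diagonal whose
-- entries are not from {0,3,6}.
offCorners : Board → Block → Fin 9 × Fin 9
offCorners M B with in036? (entry M B 0F 0F) | in036? (entry M B 2F 2F)
... | yes _ | yes _ = entry M B 0F 2F , entry M B 2F 0F
... | _ | _ = entry M B 0F 0F , entry M B 2F 2F

-- equality of two-element sets {x,y} = {u,v}
SameSet : Fin 9 × Fin 9 → Fin 9 × Fin 9 → Set
SameSet (x , y) (u , v) = ((x ≡ u) × (y ≡ v)) ⊎ ((x ≡ v) × (y ≡ u))

module Submission where

-- The difference class of two entries x, y is x − y (mod 9)
-- up to sign: ±1, ±2 or ±4.  A 3×3 array over ℤ/9 with distinct entries whose eight
-- lines all vanish mod 9 is determined by its top-left 2×2 corner, and a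
-- finite check over these corners shows:  its centre c lies in {0,3,6},
-- the outer entries of the middle row and column do not, the classes of
-- the middle row and of the middle column differ, and the off-diagonal
-- set depends only on c and on the third class (the one shared by neither).
-- Two middle rows with different centres and no common entry always have
-- the same class; hence in a Sudoku board the row class R a is constant
-- along a block row and the column class C b along a block column, and
-- R a ≢ C b for all a, b.  Finally, each block row contains a block with
-- centre j, and a pigeonhole argument on Fin 3 shows that two of these
-- blocks have the same third class, hence the same off-diagonal set.

open import Defs
open import Data.Nat using (ℕ; _+_; _∸_)
open import Data.Nat.DivMod using (_%_; m%n<n)
open import Data.Nat.Divisibility using (_∣_; _∣?_)
open import Data.Fin using (Fin; zero; suc; toℕ; fromℕ<; #_)
open import Data.Fin.Properties using (_≟_; all?; any?)
open import Data.Product using (_×_; _,_; proj₁; proj₂; ∃-syntax)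
open import Data.Product.Properties using (≡-dec)
open import Data.Sum using (_⊎_; inj₁; inj₂)
open import Function.Definitions using (Injective)
open import Relation.Nullary using (¬_; Dec; yes; no)
open import Relation.Nullary.Decidable using (toWitness; map′; ¬?; _×-dec_; _⊎-dec_; _→-dec_)
open import Relation.Binary.PropositionalEquality
  using (_≡_; _≢_; refl; sym; trans; cong; cong₂; subst₂)

sameSet-sym : ∀ {p q} → SameSet p q → SameSet q p
sameSet-sym (inj₁ (x≡u , y≡v)) = inj₁ (sym x≡u , sym y≡v)
sameSet-sym (inj₂ (x≡v , y≡u)) = inj₂ (sym y≡u , sym x≡v)

sameSet-trans : ∀ {p q r} → SameSet p q → SameSet q r → SameSet p r
sameSet-trans (inj₁ (refl , refl)) (inj₁ (refl , refl)) = inj₁ (refl , refl)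
sameSet-trans (inj₁ (refl , refl)) (inj₂ (refl , refl)) = inj₂ (refl , refl)
sameSet-trans (inj₂ (refl , refl)) (inj₁ (refl , refl)) = inj₂ (refl , refl)
sameSet-trans (inj₂ (refl , refl)) (inj₂ (refl , refl)) = inj₁ (refl , refl)

Vanishes : Fin 9 → Fin 9 → Fin 9 → Set
Vanishes x y z = 9 ∣ sum3 x y z

vanishes? : ∀ x y z → Dec (Vanishes x y z)
vanishes? x y z = 9 ∣? sum3 x y z

-- The entry closing a line: −(x + y) mod 9.
closing : Fin 9 → Fin 9 → Fin 9
closing x y = fromℕ< (m%n<n (18 ∸ (toℕ x + toℕ y)) 9)

abstract
  vanishes⇒closing : ∀ x y z → Vanishes x y z → z ≡ closing x y
  vanishes⇒closing = toWitness
    {a? = all? λ x → all? λ y → all? λ z → vanishes? x y z →-dec (z ≟ closing x y)} _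

abstract
  exhaust036 : ∀ x y z → In036 x → In036 y → In036 z → x ≢ y → x ≢ z → y ≢ z →
    ∀ j → In036 j → j ≡ x ⊎ j ≡ y ⊎ j ≡ z
  exhaust036 = toWitness
    {a? = all? λ x → all? λ y → all? λ z →
      in036? x →-dec in036? y →-dec in036? z →-dec
      ¬? (x ≟ y) →-dec ¬? (x ≟ z) →-dec ¬? (y ≟ z) →-dec
      all? λ j → in036? j →-dec ((j ≟ x) ⊎-dec (j ≟ y) ⊎-dec (j ≟ z))} _

-- The class of x − y (mod 9): ±1 ↦ 0, ±2 ↦ 1, every other residue
-- (for the pairs that occur: ±4) ↦ 2.
diffClass : Fin 9 → Fin 9 → Fin 3
diffClass x y = classOf ((toℕ x + (9 ∸ toℕ y)) % 9)
  where
  classOf : ℕ → Fin 3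
  classOf 1 = 0F
  classOf 8 = 0F
  classOf 2 = 1F
  classOf 7 = 1F
  classOf _ = 2F

third : Fin 3 → Fin 3 → Fin 3
third zero       (suc zero)       = 2F
third (suc zero) zero             = 2F
third zero       (suc (suc zero)) = 1F
third (suc (suc zero)) zero       = 1F
third _          _                = 0F

offSetOf : Fin 9 → Fin 3 → Fin 9 × Fin 9
offSetOf zero zero                               = # 4 , # 5
offSetOf zero (suc zero)                         = # 1 , # 8
offSetOf zero (suc (suc zero))                   = # 2 , # 7
offSetOf (suc (suc (suc zero))) zero             = # 7 , # 8
offSetOf (suc (suc (suc zero))) (suc zero)       = # 2 , # 4
offSetOf (suc (suc (suc zero))) (suc (suc zero)) = # 1 , # 5
offSetOf _ zero                                  = # 1 , # 2
offSetOf _ (suc zero)                            = # 5 , # 7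
offSetOf _ (suc (suc zero))                      = # 4 , # 8

Disjoint : Fin 9 × Fin 9 → Fin 9 × Fin 9 → Set
Disjoint (x , f) (y , g) = x ≢ y × x ≢ g × f ≢ y × f ≢ g

-- Two vanishing lines with distinct centres in {0,3,6}, first entries
-- outside {0,3,6} and disjoint outer pairs have the same difference class.
-- (Checked for the first entries and centres; the last entry is closing.)
abstract
  sameClassTable : ∀ x c x′ c′ → In036 c → In036 c′ → c ≢ c′ → ¬ In036 x → ¬ In036 x′ →
    Disjoint (x , closing x c) (x′ , closing x′ c′) →
    diffClass x (closing x c) ≡ diffClass x′ (closing x′ c′)
  sameClassTable = toWitness
    {a? = all? λ x → all? λ c → all? λ x′ → all? λ c′ →
      in036? c →-dec in036? c′ →-dec ¬? (c ≟ c′) →-dec ¬? (in036? x) →-dec ¬? (in036? x′) →-dec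
      (¬? (x ≟ x′) ×-dec ¬? (x ≟ closing x′ c′) ×-dec
       ¬? (closing x c ≟ x′) ×-dec ¬? (closing x c ≟ closing x′ c′)) →-dec
      (diffClass x (closing x c) ≟ diffClass x′ (closing x′ c′))} _

sameClass : ∀ {x c f x′ c′ f′} → Vanishes x c f → Vanishes x′ c′ f′ →
  In036 c → In036 c′ → c ≢ c′ → ¬ In036 x → ¬ In036 x′ →
  Disjoint (x , f) (x′ , f′) → diffClass x f ≡ diffClass x′ f′
sameClass {x} {c} {f} {x′} {c′} {f′} v v′ =
  byClosing f f′ (vanishes⇒closing x c f v) (vanishes⇒closing x′ c′ f′ v′)
  where
  byClosing : ∀ f f′ → f ≡ closing x c → f′ ≡ closing x′ c′ →
    In036 c → In036 c′ → c ≢ c′ → ¬ In036 x → ¬ In036 x′ →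
    Disjoint (x , f) (x′ , f′) → diffClass x f ≡ diffClass x′ f′
  byClosing _ _ refl refl = sameClassTable x c x′ c′

-- The function on Fin 3 with values u, v, w; it lets a statement about
-- functions Fin 3 → A be checked on their values.
fun3 : {A : Set} → A → A → A → Fin 3 → A
fun3 u v w zero             = u
fun3 u v w (suc zero)       = v
fun3 u v w (suc (suc zero)) = w

fun3-η : {A : Set} (f : Fin 3 → A) → ∀ a → fun3 (f 0F) (f 1F) (f 2F) a ≡ f a
fun3-η f zero             = refl
fun3-η f (suc zero)       = refl
fun3-η f (suc (suc zero)) = refl

TwoThirdsAgree : (Fin 3 → Fin 3) → (Fin 3 → Fin 3) → Set
TwoThirdsAgree x y = ∃[ a ] ∃[ a′ ] (a ≢ a′ × third (x a) (y a) ≡ third (x a′) (y a′))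

abstract
  pigeonTable : ∀ x₀ x₁ x₂ y₀ y₁ y₂ → let x = fun3 x₀ x₁ x₂ ; y = fun3 y₀ y₁ y₂ in
    (∀ a a′ → x a ≢ y a′) → TwoThirdsAgree x y
  pigeonTable = toWitness
    {a? = all? λ x₀ → all? λ x₁ → all? λ x₂ → all? λ y₀ → all? λ y₁ → all? λ y₂ →
      let x = fun3 x₀ x₁ x₂ ; y = fun3 y₀ y₁ y₂ in
      (all? λ a → all? λ a′ → ¬? (x a ≟ y a′)) →-dec
      (any? λ a → any? λ a′ → ¬? (a ≟ a′) ×-dec (third (x a) (y a) ≟ third (x a′) (y a′)))} _

-- If the values of x never meet those of y, then one of x, y takes a single
-- value and the other at most two, so by pigeonhole two of the classes
-- third (x a) (y a) agree.
pigeon : (x y : Fin 3 → Fin 3) → (∀ a a′ → x a ≢ y a′) → TwoThirdsAgree x y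
pigeon x y apart with pigeonTable (x 0F) (x 1F) (x 2F) (y 0F) (y 1F) (y 2F) tabulatedApart
  where
  tabulatedApart : ∀ a a′ → fun3 (x 0F) (x 1F) (x 2F) a ≢ fun3 (y 0F) (y 1F) (y 2F) a′
  tabulatedApart a a′ eq = apart a a′ (trans (sym (fun3-η x a)) (trans eq (fun3-η y a′)))
... | a , a′ , a≢a′ , agree = a , a′ , a≢a′ ,
  trans (sym (thirdAt a)) (trans agree (thirdAt a′))
  where
  thirdAt : ∀ a → third (fun3 (x 0F) (x 1F) (x 2F) a) (fun3 (y 0F) (y 1F) (y 2F) a) ≡ third (x a) (y a)
  thirdAt a = cong₂ third (fun3-η x a) (fun3-η y a)

Square : Set
Square = Fin 3 → Fin 3 → Fin 9

square : (a b c d e f g h i : Fin 9) → Square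
square a b c d e f g h i zero             zero             = a
square a b c d e f g h i zero             (suc zero)       = b
square a b c d e f g h i zero             (suc (suc zero)) = c
square a b c d e f g h i (suc zero)       zero             = d
square a b c d e f g h i (suc zero)       (suc zero)       = e
square a b c d e f g h i (suc zero)       (suc (suc zero)) = f
square a b c d e f g h i (suc (suc zero)) zero             = g
square a b c d e f g h i (suc (suc zero)) (suc zero)       = h
square a b c d e f g h i (suc (suc zero)) (suc (suc zero)) = i

square-η : (s : Square) (i k : Fin 3) →
  square (s 0F 0F) (s 0F 1F) (s 0F 2F) (s 1F 0F) (s 1F 1F) (s 1F 2F) (s 2F 0F) (s 2F 1F) (s 2F 2F) i k
    ≡ s i k
square-η s zero             zero             = refl
square-η s zero             (suc zero)       = refl
square-η s zero             (suc (suc zero)) = refl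
square-η s (suc zero)       zero             = refl
square-η s (suc zero)       (suc zero)       = refl
square-η s (suc zero)       (suc (suc zero)) = refl
square-η s (suc (suc zero)) zero             = refl
square-η s (suc (suc zero)) (suc zero)       = refl
square-η s (suc (suc zero)) (suc (suc zero)) = refl

-- The only candidate for a magic square with top-left corner a b / d e:
-- every further entry is forced by a vanishing row, column or the main
-- diagonal.
completion : Fin 9 → Fin 9 → Fin 9 → Fin 9 → Square
completion a b d e =
  square a b (closing a b) d e (closing d e) (closing a d) (closing b e) (closing a e)

-- This predicate, like 'ShapeConditions' below,
-- mentions a square only at literal positions, so for it 'P s' and
-- 'P (square (s 0F 0F) … (s 2F 2F))' are definitionally equal.
IsMagic : Square → Set
IsMagic s =
  Vanishes (s 0F 0F) (s 0F 1F) (s 0F 2F) × Vanishes (s 1F 0F) (s 1F 1F) (s 1F 2F) ×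
  Vanishes (s 2F 0F) (s 2F 1F) (s 2F 2F) ×
  Vanishes (s 0F 0F) (s 1F 0F) (s 2F 0F) × Vanishes (s 0F 1F) (s 1F 1F) (s 2F 1F) ×
  Vanishes (s 0F 2F) (s 1F 2F) (s 2F 2F) ×
  Vanishes (s 0F 0F) (s 1F 1F) (s 2F 2F) × Vanishes (s 0F 2F) (s 1F 1F) (s 2F 0F)

isMagic? : ∀ s → Dec (IsMagic s)
isMagic? s =
  vanishes? (s 0F 0F) (s 0F 1F) (s 0F 2F) ×-dec vanishes? (s 1F 0F) (s 1F 1F) (s 1F 2F) ×-dec
  vanishes? (s 2F 0F) (s 2F 1F) (s 2F 2F) ×-dec
  vanishes? (s 0F 0F) (s 1F 0F) (s 2F 0F) ×-dec vanishes? (s 0F 1F) (s 1F 1F) (s 2F 1F) ×-dec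
  vanishes? (s 0F 2F) (s 1F 2F) (s 2F 2F) ×-dec
  vanishes? (s 0F 0F) (s 1F 1F) (s 2F 2F) ×-dec vanishes? (s 0F 2F) (s 1F 1F) (s 2F 0F)

Distinct : Square → Set
Distinct s = Injective _≡_ _≡_ (λ (p : Fin 3 × Fin 3) → s (proj₁ p) (proj₂ p))

distinct? : ∀ s → Dec (Distinct s)
distinct? s =
  map′ (λ inj {p} {q} → inj (proj₁ p) (proj₂ p) (proj₁ q) (proj₂ q)) (λ inj i k i′ k′ → inj)
    (all? λ i → all? λ k → all? λ i′ → all? λ k′ →
      (s i k ≟ s i′ k′) →-dec ≡-dec _≟_ _≟_ (i , k) (i′ , k′))

rowClass colClass : Square → Fin 3
rowClass s = diffClass (s 1F 0F) (s 1F 2F)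
colClass s = diffClass (s 0F 1F) (s 2F 1F)

offPair : (x₀₀ x₂₂ x₀₂ x₂₀ : Fin 9) → Fin 9 × Fin 9
offPair x₀₀ x₂₂ x₀₂ x₂₀ with in036? x₀₀ | in036? x₂₂
... | yes _ | yes _ = x₀₂ , x₂₀
... | _     | _     = x₀₀ , x₂₂

offSet : Square → Fin 9 × Fin 9
offSet s = offPair (s 0F 0F) (s 2F 2F) (s 0F 2F) (s 2F 0F)

record Shape (s : Square) : Set where
  field
    centre∈036    : In036 (s 1F 1F)
    midRow∉036    : ¬ In036 (s 1F 0F)
    midCol∉036    : ¬ In036 (s 0F 1F)
    classesDiffer : rowClass s ≢ colClass s
    offSetFormula : SameSet (offSet s) (offSetOf (s 1F 1F) (third (rowClass s) (colClass s)))

ShapeConditions : Square → Set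
ShapeConditions s =
  In036 (s 1F 1F) × ¬ In036 (s 1F 0F) × ¬ In036 (s 0F 1F) × rowClass s ≢ colClass s ×
  SameSet (offSet s) (offSetOf (s 1F 1F) (third (rowClass s) (colClass s)))

shapeConditions? : ∀ s → Dec (ShapeConditions s)
shapeConditions? s =
  in036? (s 1F 1F) ×-dec ¬? (in036? (s 1F 0F)) ×-dec ¬? (in036? (s 0F 1F)) ×-dec
  ¬? (rowClass s ≟ colClass s) ×-dec sameSet? (offSet s) (offSetOf (s 1F 1F) (third (rowClass s) (colClass s)))
  where
  sameSet? : ∀ p q → Dec (SameSet p q)
  sameSet? (x , y) (u , v) = ((x ≟ u) ×-dec (y ≟ v)) ⊎-dec ((x ≟ v) ×-dec (y ≟ u))

toShape : ∀ {s} → ShapeConditions s → Shape s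
toShape (c , r , k , d , o) = record
  { centre∈036 = c ; midRow∉036 = r ; midCol∉036 = k ; classesDiffer = d ; offSetFormula = o }

abstract
  completionShape : ∀ a b d e → IsMagic (completion a b d e) → Distinct (completion a b d e) →
    ShapeConditions (completion a b d e)
  completionShape = toWitness
    {a? = all? λ a → all? λ b → all? λ d → all? λ e →
      isMagic? (completion a b d e) →-dec distinct? (completion a b d e) →-dec
      shapeConditions? (completion a b d e)} _

-- Every magic square with distinct entries has the shape above: it is the
-- completion of its own top-left corner.
shape : ∀ s → IsMagic s → Distinct s → Shape s
shape s magic@(row₀ , row₁ , _ , col₀ , col₁ , _ , diag , _) inj =
  toShape {s} (byCorner (s 0F 0F) (s 0F 1F) (s 0F 2F) (s 1F 0F) (s 1F 1F) (s 1F 2F)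
                        (s 2F 0F) (s 2F 1F) (s 2F 2F)
    (vanishes⇒closing (s 0F 0F) (s 0F 1F) (s 0F 2F) row₀)
    (vanishes⇒closing (s 1F 0F) (s 1F 1F) (s 1F 2F) row₁)
    (vanishes⇒closing (s 0F 0F) (s 1F 0F) (s 2F 0F) col₀)
    (vanishes⇒closing (s 0F 1F) (s 1F 1F) (s 2F 1F) col₁)
    (vanishes⇒closing (s 0F 0F) (s 1F 1F) (s 2F 2F) diag)
    magic tabulatedInj)
  where
  tabulatedInj : Distinct (square (s 0F 0F) (s 0F 1F) (s 0F 2F) (s 1F 0F) (s 1F 1F) (s 1F 2F)
                                  (s 2F 0F) (s 2F 1F) (s 2F 2F))
  tabulatedInj {i , k} {i′ , k′} eq = inj (trans (sym (square-η s i k)) (trans eq (square-η s i′ k′)))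

  byCorner : ∀ a b c d e f g h i →
    c ≡ closing a b → f ≡ closing d e → g ≡ closing a d → h ≡ closing b e → i ≡ closing a e →
    IsMagic (square a b c d e f g h i) → Distinct (square a b c d e f g h i) →
    ShapeConditions (square a b c d e f g h i)
  byCorner a b _ d e _ _ _ _ refl refl refl refl refl = completionShape a b d e

abstract
  idx-injective : ∀ b k b′ k′ → idx b k ≡ idx b′ k′ → b ≡ b′
  idx-injective = toWitness
    {a? = all? λ b → all? λ k → all? λ b′ → all? λ k′ → (idx b k ≟ idx b′ k′) →-dec (b ≟ b′)} _

offCorners≡offSet : ∀ M B → offCorners M B ≡ offSet (entry M B)
offCorners≡offSet M B with in036? (entry M B 0F 0F) | in036? (entry M B 2F 2F)
... | yes _ | yes _ = refl
... | yes _ | no _  = refl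
... | no _  | _     = refl

module OnBoard (M : Board) (modularMagic : IsModularMagic M) where

  sudoku : IsSudoku M
  sudoku = proj₁ modularMagic

  blockMagic : ∀ B → IsMagic (entry M B)
  blockMagic B with proj₂ modularMagic B
  ... | rows , cols , diag , anti =
    rows 0F , rows 1F , rows 2F , cols 0F , cols 1F , cols 2F , diag , anti

  blockShape : ∀ B → Shape (entry M B)
  blockShape B = shape (entry M B) (blockMagic B) (proj₂ (proj₂ sudoku) B)

  open Shape

  rowApart : ∀ a {b b′} i k k′ → b ≢ b′ → entry M (a , b) i k ≢ entry M (a , b′) i k′
  rowApart a {b} {b′} i k k′ b≢b′ eq = b≢b′ (idx-injective b k b′ k′ (proj₁ sudoku (idx a i) eq))

  colApart : ∀ {a a′} b i i′ k → a ≢ a′ → entry M (a , b) i k ≢ entry M (a′ , b) i′ k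
  colApart {a} {a′} b i i′ k a≢a′ eq =
    a≢a′ (idx-injective a i a′ i′ (proj₁ (proj₂ sudoku) (idx b k) eq))

  rowClass-constant : ∀ a b b′ → rowClass (entry M (a , b)) ≡ rowClass (entry M (a , b′))
  rowClass-constant a b b′ with b ≟ b′
  ... | yes refl = refl
  ... | no b≢b′  = sameClass (middleRow (a , b)) (middleRow (a , b′))
    (centre∈036 (blockShape (a , b))) (centre∈036 (blockShape (a , b′))) (rowApart a 1F 1F 1F b≢b′)
    (midRow∉036 (blockShape (a , b))) (midRow∉036 (blockShape (a , b′)))
    (rowApart a 1F 0F 0F b≢b′ , rowApart a 1F 0F 2F b≢b′ ,
     rowApart a 1F 2F 0F b≢b′ , rowApart a 1F 2F 2F b≢b′)
    where
    middleRow : ∀ B → Vanishes (entry M B 1F 0F) (entry M B 1F 1F) (entry M B 1F 2F)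
    middleRow B = proj₁ (proj₂ modularMagic B) 1F

  colClass-constant : ∀ a a′ b → colClass (entry M (a , b)) ≡ colClass (entry M (a′ , b))
  colClass-constant a a′ b with a ≟ a′
  ... | yes refl = refl
  ... | no a≢a′  = sameClass (middleCol (a , b)) (middleCol (a′ , b))
    (centre∈036 (blockShape (a , b))) (centre∈036 (blockShape (a′ , b))) (colApart b 1F 1F 1F a≢a′)
    (midCol∉036 (blockShape (a , b))) (midCol∉036 (blockShape (a′ , b)))
    (colApart b 0F 0F 1F a≢a′ , colApart b 0F 2F 1F a≢a′ ,
     colApart b 2F 0F 1F a≢a′ , colApart b 2F 2F 1F a≢a′)
    where
    middleCol : ∀ B → Vanishes (entry M B 0F 1F) (entry M B 1F 1F) (entry M B 2F 1F)
    middleCol B = proj₁ (proj₂ (proj₂ modularMagic B)) 1F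

  R C : Fin 3 → Fin 3
  R a = rowClass (entry M (a , 0F))
  C b = colClass (entry M (0F , b))

  classesApart : ∀ a b → R a ≢ C b
  classesApart a b R≡C = classesDiffer (blockShape (a , b))
    (trans (rowClass-constant a b 0F) (trans R≡C (colClass-constant 0F a b)))

  offCornersFormula : ∀ a b →
    SameSet (offCorners M (a , b)) (offSetOf (center M (a , b)) (third (R a) (C b)))
  offCornersFormula a b
    rewrite offCorners≡offSet M (a , b) | sym (rowClass-constant a b 0F) | colClass-constant 0F a b
    = offSetFormula (blockShape (a , b))

  sameOffCorners : ∀ {a b a′ b′} → center M (a , b) ≡ center M (a′ , b′) →
    third (R a) (C b) ≡ third (R a′) (C b′) → SameSet (offCorners M (a , b)) (offCorners M (a′ , b′))
  sameOffCorners {a} {b} {a′} {b′} sameCentre sameThird = sameSet-trans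
    (subst₂ (λ c t → SameSet (offCorners M (a , b)) (offSetOf c t)) sameCentre sameThird
      (offCornersFormula a b))
    (sameSet-sym (offCornersFormula a′ b′))

  centreInRow : ∀ j → In036 j → ∀ a → ∃[ b ] center M (a , b) ≡ j
  centreInRow j j∈036 a with exhaust036 (centre 0F) (centre 1F) (centre 2F)
    (centre∈036 (blockShape (a , 0F))) (centre∈036 (blockShape (a , 1F)))
    (centre∈036 (blockShape (a , 2F)))
    (rowApart a {0F} {1F} 1F 1F 1F λ ()) (rowApart a {0F} {2F} 1F 1F 1F λ ())
    (rowApart a {1F} {2F} 1F 1F 1F λ ()) j j∈036
    where
    centre : Fin 3 → Fin 9
    centre b = center M (a , b)
  ... | inj₁ j≡c₀        = 0F , sym j≡c₀
  ... | inj₂ (inj₁ j≡c₁) = 1F , sym j≡c₁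
  ... | inj₂ (inj₂ j≡c₂) = 2F , sym j≡c₂

lemma1 : (M : Board) → IsModularMagic M → (j : Fin 9) → In036 j →
    ∃[ B ] ∃[ B′ ] (B ≢ B′ × center M B ≡ j × center M B′ ≡ j ×
      SameSet (offCorners M B) (offCorners M B′))
lemma1 M modularMagic j j∈036 =
  let (a , a′ , a≢a′ , sameThird) = pigeon R (λ a → C (col a)) (λ a a′ → classesApart a (col a′))
  in (a , col a) , (a′ , col a′) , (λ eq → a≢a′ (cong proj₁ eq)) , hits a , hits a′ ,
     sameOffCorners (trans (hits a) (sym (hits a′))) sameThird
  where
  open OnBoard M modularMagic
  col : Fin 3 → Fin 3
  col a = proj₁ (centreInRow j j∈036 a)
  hits : ∀ a → center M (a , col a) ≡ j
  hits a = proj₂ (centreInRow j j∈036 a)
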